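{- Let $m,n$ be positive integers, let $\mathbf{r}=(r_1,r_2,r_3,\dots,r_m)\in\mathbb{Z}^m$ with $r_1\ge r_2$, let $\mathbf{r}'=(r_1+2,r_2-2,r_3,\dots,r_m)$, and let $\mathbf{c}\in\mathbb{Z}^n$ be any column-sum vector. Then $|A_{\mathbf{r},\mathbf{c}}(m,n)|\ge|A_{\mathbf{r}',\mathbf{c}}(m,n)|$.
   Context: For $\mathbf{r}\in\mathbb{Z}^m$ and $\mathbf{c}\in\mathbb{Z}^n$, $A_{\mathbf{r},\mathbf{c}}(m,n)$ is the set of $m\times n$ matrices with all entries in $\{1,-1\}$ whose vector of row sums is $\mathbf{r}$ and whose vector of column sums is $\mathbf{c}$. -}

module Defs where

open import Data.Nat using (ℕ; zero; suc)
open import Data.Fin using (Fin; zero; suc)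
open import Data.Integer using (ℤ; +_; -[1+_]; _+_; _-_)
open import Data.List using (List; []; _∷_; map; concatMap; length; filter)
open import Data.Product using (_×_; _,_)
open import Relation.Binary.PropositionalEquality using (_≡_)
open import Relation.Nullary using (Dec)
open import Relation.Nullary.Decidable using (_×-dec_)

data Sign : Set where
  plus minus : Sign

val : Sign → ℤ
val plus  = + 1
val minus = -[1+ 0 ]

Matrix : ℕ → ℕ → Set
Matrix m n = Fin m → Fin n → Sign

∑ : (n : ℕ) → (Fin n → ℤ) → ℤ
∑ zero    f = + 0
∑ (suc n) f = f zero + ∑ n (λ i → f (suc i))

rowSums : ∀ {m n} → Matrix m n → Fin m → ℤ
rowSums {m} {n} M i = ∑ n (λ j → val (M i j))

colSums : ∀ {m n} → Matrix m n → Fin n → ℤ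
colSums {m} {n} M j = ∑ m (λ i → val (M i j))

_≐_ : ∀ {k} → (Fin k → ℤ) → (Fin k → ℤ) → Set
_≐_ {k} f g = (i : Fin k) → f i ≡ g i

allFuns : ∀ {A : Set} → List A → (k : ℕ) → List (Fin k → A)
allFuns xs zero    = (λ ()) ∷ []
allFuns xs (suc k) =
  concatMap (λ a → map (λ f → λ { zero → a ; (suc i) → f i }) (allFuns xs k)) xs

allSigns : List Sign
allSigns = plus ∷ minus ∷ []

allMatrices : (m n : ℕ) → List (Matrix m n)
allMatrices m n = allFuns (allFuns allSigns n) m

≐? : ∀ k → (f g : Fin k → ℤ) → Dec (f ≐ g)
≐? k f g = Data.Fin.Properties.all? (λ i → f i Data.Integer.≟ g i)
  where import Data.Fin.Properties; import Data.Integer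

countA : (m n : ℕ) → (Fin m → ℤ) → (Fin n → ℤ) → ℕ
countA m n r c =
  length (filter (λ M → ≐? m (rowSums M) r ×-dec ≐? n (colSums M) c) (allMatrices m n))

shift : ∀ {k} → (Fin (suc (suc k)) → ℤ) → Fin (suc (suc k)) → ℤ
shift r zero             = r zero + + 2
shift r (suc zero)       = r (suc zero) - + 2
shift r (suc (suc i))    = r (suc (suc i))

module Submission where

-- We inject A_{r′,c} into A_{r,c}.
-- Read the top two rows of M ∈ A_{r′,c} as a sequence of columns (x_j, y_j) and let
-- the excess of a column be (x_j - y_j)/2 ∈ {-1, 0, 1}.  The total excess is
-- (r₁ + 2 - (r₂ - 2))/2 ≥ 2, and the partial excesses move in steps of at most 1
-- from 0, so some shortest prefix has excess exactly 1.  Swapping the two entries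
-- in every column of that prefix moves 2 from row 1 to row 2 and keeps every
-- column sum, giving a matrix in A_{r,c}.  In the result the same prefix is the
-- shortest one with excess -1, so the map is undone by the same scan with the
-- opposite target and is injective.

open import Defs
open import Level using (0ℓ)
open import Data.Nat using (ℕ; zero; suc; z≤n; _≥_) renaming (_≤_ to _≤ℕ_)
open import Data.Fin using (Fin; zero; suc)
open import Data.Fin.Properties using (injective⇒≤)
open import Data.List using ([]; _∷_; map; length; filter; concatMap; cartesianProductWith; lookup; _++_)
open import Data.List.Properties using (length-map)
open import Data.List.Relation.Unary.All as All using (All; []; _∷_)
open import Data.List.Relation.Unary.All.Properties using (all-filter; map⁺)
open import Data.List.Relation.Unary.AllPairs.Core using ([]; _∷_)
open import Data.List.Relation.Unary.Any as Any using (here; there)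
open import Data.List.Membership.Propositional.Properties using (∈-lookup)
import Data.List.Membership.Setoid as Membership
open import Data.List.Membership.Setoid.Properties
  using (index-injective; ∈-resp-≈; ∈-filter⁺; ∈-cartesianProductWith⁺)
import Data.List.Relation.Unary.Unique.Setoid as UniqueSetoid
import Data.List.Relation.Unary.Unique.Setoid.Properties as Unique
open import Data.Vec.Functional.Relation.Binary.Equality.Setoid using (≋-setoid)
open import Data.Product using (_×_; _,_; proj₁; proj₂; swap)
open import Data.Sum using (_⊎_; inj₁; inj₂)
open import Data.Integer using (ℤ; +_; +[1+_]; -[1+_]; _+_; _-_; -_; _≤_; +≤+)
import Data.Integer.Properties as ℤ
open import Data.Integer.Tactic.RingSolver using (solve-∀)
open import Data.Empty using (⊥-elim)
open import Relation.Binary.Bundles using (Setoid)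
open import Relation.Binary.Definitions using (_Respects_)
open import Relation.Unary using (Pred; Decidable)
open import Relation.Nullary.Decidable using (_×-dec_)
import Relation.Binary.PropositionalEquality as ≡
open import Relation.Binary.PropositionalEquality using (_≡_; refl; sym; trans; cong; cong₂; subst; module ≡-Reasoning)

module Counting {a ℓ} (S : Setoid a ℓ) where

  open Setoid S using (_≈_) renaming (Carrier to X; sym to ≈-sym)
  open Membership S using (_∈_)
  open UniqueSetoid S using (Unique)

  lookup-injective : ∀ {xs} → Unique xs → ∀ {i j} → lookup xs i ≈ lookup xs j → i ≡ j
  lookup-injective (_ ∷ _) {zero} {zero} _ = refl
  lookup-injective (x≉xs ∷ _) {zero} {suc j} x≈ = ⊥-elim (All.lookup x≉xs (∈-lookup j) x≈)
  lookup-injective (x≉xs ∷ _) {suc i} {zero} ≈x = ⊥-elim (All.lookup x≉xs (∈-lookup i) (≈-sym ≈x))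
  lookup-injective (_ ∷ xs!) {suc i} {suc j} e = cong suc (lookup-injective xs! e)

  -- Pigeonhole: a list without repetitions, all of whose entries occur in ys,
  -- is no longer than ys (send each entry to the position where it occurs in ys).
  unique⊆⇒length≤ : ∀ {xs ys} → Unique xs → All (_∈ ys) xs → length xs ≤ℕ length ys
  unique⊆⇒length≤ {xs} {ys} xs! xs⊆ys = injective⇒≤ position-injective
    where
      occurrence : ∀ i → lookup xs i ∈ ys
      occurrence i = All.lookup xs⊆ys (∈-lookup i)

      position-injective : ∀ {i j} → Any.index (occurrence i) ≡ Any.index (occurrence j) → i ≡ j
      position-injective {i} {j} e =
        lookup-injective xs! (index-injective S (occurrence i) (occurrence j) e)

  count-mono : ∀ {p q} {P : Pred X p} {Q : Pred X q} (P? : Decidable P) (Q? : Decidable Q) →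
    P Respects _≈_ → (f : X → X) → (∀ {x} → Q x → P (f x)) → (∀ {x y} → f x ≈ f y → x ≈ y) →
    ∀ xs → (∀ x → x ∈ xs) → Unique xs → length (filter Q? xs) ≤ℕ length (filter P? xs)
  count-mono P? Q? P-resp f f-maps f-injective xs complete xs! =
    subst (_≤ℕ length (filter P? xs)) (length-map f (filter Q? xs))
      (unique⊆⇒length≤ (Unique.map⁺ S S f-injective (Unique.filter⁺ S Q? xs!))
        (map⁺ (All.map (λ {x} qx → ∈-filter⁺ S P? P-resp (complete (f x)) (f-maps qx))
                        (all-filter Q? xs))))

concatMap-map≡cartesianProductWith : ∀ {a b c} {A : Set a} {B : Set b} {C : Set c}
  (f : A → B → C) xs ys → concatMap (λ x → map (f x) ys) xs ≡ cartesianProductWith f xs ys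
concatMap-map≡cartesianProductWith f [] ys = refl
concatMap-map≡cartesianProductWith f (x ∷ xs) ys =
  cong (map (f x) ys ++_) (concatMap-map≡cartesianProductWith f xs ys)

module Enumeration {ℓ} (S : Setoid 0ℓ ℓ) where

  open Setoid S using () renaming (Carrier to A; refl to ≈-refl)
  open Membership S using (_∈_)
  open UniqueSetoid S using (Unique)

  Funs : ℕ → Setoid 0ℓ ℓ
  Funs = ≋-setoid S

  -- allFuns xs (suc k) pairs each head in xs with each tail in allFuns xs k,
  -- so completeness and uniqueness follow from those of cartesian products.
  allFuns-complete : ∀ {xs} → (∀ x → x ∈ xs) →
    ∀ k (f : Fin k → A) → Membership._∈_ (Funs k) f (allFuns xs k)
  allFuns-complete complete zero f = here (λ ())
  allFuns-complete {xs} complete (suc k) f =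
    subst (Membership._∈_ (Funs (suc k)) f) (sym (concatMap-map≡cartesianProductWith _ xs (allFuns xs k)))
      (∈-resp-≈ (Funs (suc k)) (λ { zero → ≈-refl ; (suc i) → ≈-refl })
        (∈-cartesianProductWith⁺ S (Funs k) (Funs (suc k))
          (λ { x≈y g≋h zero → x≈y ; x≈y g≋h (suc i) → g≋h i })
          (complete (f zero)) (allFuns-complete complete k (λ i → f (suc i)))))

  allFuns-unique : ∀ {xs} → Unique xs → ∀ k → UniqueSetoid.Unique (Funs k) (allFuns xs k)
  allFuns-unique xs! zero = [] ∷ []
  allFuns-unique {xs} xs! (suc k) =
    subst (UniqueSetoid.Unique (Funs (suc k))) (sym (concatMap-map≡cartesianProductWith _ xs (allFuns xs k)))
      (Unique.cartesianProductWith⁺ S (Funs k) (Funs (suc k)) _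
        (λ e → e zero , λ i → e (suc i)) xs! (allFuns-unique xs! k))

Matrices : ℕ → ℕ → Setoid 0ℓ 0ℓ
Matrices m n = ≋-setoid (≋-setoid (≡.setoid Sign) n) m

allSigns-complete : ∀ s → Membership._∈_ (≡.setoid Sign) s allSigns
allSigns-complete plus  = here refl
allSigns-complete minus = there (here refl)

allSigns-unique : UniqueSetoid.Unique (≡.setoid Sign) allSigns
allSigns-unique = ((λ ()) ∷ []) ∷ [] ∷ []

allMatrices-complete : ∀ m n (M : Matrix m n) → Membership._∈_ (Matrices m n) M (allMatrices m n)
allMatrices-complete m n = Enumeration.allFuns-complete (≋-setoid (≡.setoid Sign) n)
  (Enumeration.allFuns-complete (≡.setoid Sign) allSigns-complete n) m

allMatrices-unique : ∀ m n → UniqueSetoid.Unique (Matrices m n) (allMatrices m n)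
allMatrices-unique m n = Enumeration.allFuns-unique (≋-setoid (≡.setoid Sign) n)
  (Enumeration.allFuns-unique (≡.setoid Sign) allSigns-unique n) m

-- The top two rows of a sign matrix, read column by column.
Column : Set
Column = Sign × Sign

-- Half the difference of the two entries: how much a column favours the first row.
excess : Column → ℤ
excess (plus , plus)   = + 0
excess (plus , minus)  = + 1
excess (minus , plus)  = - (+ 1)
excess (minus , minus) = + 0

excess-swap : ∀ p → excess (swap p) ≡ - excess p
excess-swap (plus , plus)   = refl
excess-swap (plus , minus)  = refl
excess-swap (minus , plus)  = refl
excess-swap (minus , minus) = refl

val-excess : ∀ p → val (proj₁ p) ≡ val (proj₂ p) + (excess p + excess p)
val-excess (plus , plus)   = refl
val-excess (plus , minus)  = refl
val-excess (minus , plus)  = refl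
val-excess (minus , minus) = refl

step-nonneg : ∀ m p → + 0 ≤ +[1+ m ] - excess p
step-nonneg m (plus , plus)   = +≤+ z≤n
step-nonneg m (plus , minus)  = +≤+ z≤n
step-nonneg m (minus , plus)  = +≤+ z≤n
step-nonneg m (minus , minus) = +≤+ z≤n

upper lower : ∀ {n} → (Fin n → Column) → ℤ
upper {n} w = ∑ n (λ j → val (proj₁ (w j)))
lower {n} w = ∑ n (λ j → val (proj₂ (w j)))

-- Scan the columns left to right, swapping them until the swapped ones have
-- total excess t (that is, swap the shortest prefix of excess t, if there is one).
-- Properties of exchange are proved by the same recursion; a nonzero target is
-- matched as +[1+ _] or -[1+ _] so that exchange unfolds.
exchange : ℤ → ∀ {n} → (Fin n → Column) → Fin n → Column
exchange (+ 0) w j       = w j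
exchange t     w zero    = swap (w zero)
exchange t     w (suc j) = exchange (t - excess (w zero)) (λ i → w (suc i)) j

exchange-kept-or-swapped : ∀ t {n} (w : Fin n → Column) j →
  exchange t w j ≡ w j ⊎ exchange t w j ≡ swap (w j)
exchange-kept-or-swapped (+ 0)      w j       = inj₁ refl
exchange-kept-or-swapped +[1+ m ]   w zero    = inj₂ refl
exchange-kept-or-swapped -[1+ m ]   w zero    = inj₂ refl
exchange-kept-or-swapped t@(+[1+ _ ]) w (suc j) =
  exchange-kept-or-swapped (t - excess (w zero)) (λ i → w (suc i)) j
exchange-kept-or-swapped t@(-[1+ _ ]) w (suc j) =
  exchange-kept-or-swapped (t - excess (w zero)) (λ i → w (suc i)) j

exchange-cong : ∀ t {n} {v w : Fin n → Column} → (∀ j → v j ≡ w j) →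
  ∀ j → exchange t v j ≡ exchange t w j
exchange-cong (+ 0)      v≗w j       = v≗w j
exchange-cong +[1+ m ]   v≗w zero    = cong swap (v≗w zero)
exchange-cong -[1+ m ]   v≗w zero    = cong swap (v≗w zero)
exchange-cong t@(+[1+ _ ]) {w = w} v≗w (suc j) rewrite v≗w zero =
  exchange-cong (t - excess (w zero)) (λ i → v≗w (suc i)) j
exchange-cong t@(-[1+ _ ]) {w = w} v≗w (suc j) rewrite v≗w zero =
  exchange-cong (t - excess (w zero)) (λ i → v≗w (suc i)) j

-- Swapping a column negates its excess, so the opposite target retraces the same prefix.
retrace-target : ∀ t p → - t - excess (swap p) ≡ - (t - excess p)
retrace-target t p = trans (cong (λ e → - t - e) (excess-swap p)) (negate-difference t (excess p))
  where
    negate-difference : ∀ t e → - t - - e ≡ - (t - e)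
    negate-difference = solve-∀

exchange-inverse : ∀ t {n} (w : Fin n → Column) j → exchange (- t) (exchange t w) j ≡ w j
exchange-inverse (+ 0)      w j    = refl
exchange-inverse +[1+ m ]   w zero = refl
exchange-inverse -[1+ m ]   w zero = refl
exchange-inverse t@(+[1+ _ ]) w (suc j) =
  subst (λ s → exchange s (exchange (t - excess (w zero)) (λ i → w (suc i))) j ≡ w (suc j))
    (sym (retrace-target t (w zero))) (exchange-inverse (t - excess (w zero)) (λ i → w (suc i)) j)
exchange-inverse t@(-[1+ _ ]) w (suc j) =
  subst (λ s → exchange s (exchange (t - excess (w zero)) (λ i → w (suc i))) j ≡ w (suc j))
    (sym (retrace-target t (w zero))) (exchange-inverse (t - excess (w zero)) (λ i → w (suc i)) j)

exchange-moves : ∀ {n} t (w : Fin n → Column) → + 0 ≤ t → lower w + (t + t) ≤ upper w →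
  upper (exchange t w) ≡ upper w - (t + t) × lower (exchange t w) ≡ lower w + (t + t)
exchange-moves (+ 0) w _ _ = sym (ℤ.+-identityʳ (upper w)) , sym (ℤ.+-identityʳ (lower w))
exchange-moves {zero} +[1+ m ] w _ (+≤+ ())
exchange-moves {suc n} t@(+[1+ m ]) w _ gap = moved-upper , moved-lower
  where
    x y e t′ U L : ℤ
    x = val (proj₁ (w zero))
    y = val (proj₂ (w zero))
    e = excess (w zero)
    t′ = t - e
    x≡y+2e : x ≡ y + (e + e)
    x≡y+2e = val-excess (w zero)
    rest : Fin n → Column
    rest i = w (suc i)
    U = upper rest
    L = lower rest

    rest-gap : L + (t′ + t′) ≤ U
    rest-gap = begin
      L + (t′ + t′)                       ≡⟨ remove-first y e L t ⟩
      ((y + L) + (t + t)) - (y + (e + e)) ≤⟨ ℤ.+-monoˡ-≤ (- (y + (e + e))) gap ⟩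
      (x + U) - (y + (e + e))             ≡⟨ cong (λ z → (z + U) - (y + (e + e))) x≡y+2e ⟩
      ((y + (e + e)) + U) - (y + (e + e)) ≡⟨ cancel (y + (e + e)) U ⟩
      U                                   ∎
      where
        open ℤ.≤-Reasoning
        remove-first : ∀ y e L t → L + ((t - e) + (t - e)) ≡ ((y + L) + (t + t)) - (y + (e + e))
        remove-first = solve-∀
        cancel : ∀ a U → (a + U) - a ≡ U
        cancel = solve-∀

    moves-rest : upper (exchange t′ rest) ≡ U - (t′ + t′) × lower (exchange t′ rest) ≡ L + (t′ + t′)
    moves-rest = exchange-moves t′ rest (step-nonneg m (w zero)) rest-gap

    moved-upper : y + upper (exchange t′ rest) ≡ (x + U) - (t + t)
    moved-upper = begin
      y + upper (exchange t′ rest)   ≡⟨ cong (_+_ y) (proj₁ moves-rest) ⟩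
      y + (U - (t′ + t′))            ≡⟨ regroup y e U t ⟩
      ((y + (e + e)) + U) - (t + t)  ≡⟨ cong (λ z → (z + U) - (t + t)) (sym x≡y+2e) ⟩
      (x + U) - (t + t)              ∎
      where
        open ≡-Reasoning
        regroup : ∀ y e U t → y + (U - ((t - e) + (t - e))) ≡ ((y + (e + e)) + U) - (t + t)
        regroup = solve-∀

    moved-lower : x + lower (exchange t′ rest) ≡ (y + L) + (t + t)
    moved-lower = begin
      x + lower (exchange t′ rest)    ≡⟨ cong₂ _+_ x≡y+2e (proj₂ moves-rest) ⟩
      (y + (e + e)) + (L + (t′ + t′)) ≡⟨ regroup y e L t ⟩
      (y + L) + (t + t)               ∎
      where
        open ≡-Reasoning
        regroup : ∀ y e L t → (y + (e + e)) + (L + ((t - e) + (t - e))) ≡ (y + L) + (t + t)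
        regroup = solve-∀

_≈ₘ_ : ∀ {m n} → Matrix m n → Matrix m n → Set
M ≈ₘ N = ∀ i j → M i j ≡ N i j

topRows : ∀ {k n} → Matrix (suc (suc k)) n → Fin n → Column
topRows M j = M zero j , M (suc zero) j

withTopRows : ∀ {k n} → Matrix (suc (suc k)) n → (Fin n → Column) → Matrix (suc (suc k)) n
withTopRows M w zero          j = proj₁ (w j)
withTopRows M w (suc zero)    j = proj₂ (w j)
withTopRows M w (suc (suc i)) j = M (suc (suc i)) j

transfer : ∀ {k n} → ℤ → Matrix (suc (suc k)) n → Matrix (suc (suc k)) n
transfer t M = withTopRows M (exchange t (topRows M))

transfer-inverse : ∀ {k n} t (M : Matrix (suc (suc k)) n) → transfer (- t) (transfer t M) ≈ₘ M
transfer-inverse t M zero          j = cong proj₁ (exchange-inverse t (topRows M) j)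
transfer-inverse t M (suc zero)    j = cong proj₂ (exchange-inverse t (topRows M) j)
transfer-inverse t M (suc (suc i)) j = refl

topRows-cong : ∀ {k n} {M N : Matrix (suc (suc k)) n} → M ≈ₘ N → ∀ j → topRows M j ≡ topRows N j
topRows-cong M≈N j = cong₂ _,_ (M≈N zero j) (M≈N (suc zero) j)

transfer-cong : ∀ {k n} t {M N : Matrix (suc (suc k)) n} → M ≈ₘ N → transfer t M ≈ₘ transfer t N
transfer-cong t M≈N zero          j = cong proj₁ (exchange-cong t (topRows-cong M≈N) j)
transfer-cong t M≈N (suc zero)    j = cong proj₂ (exchange-cong t (topRows-cong M≈N) j)
transfer-cong t M≈N (suc (suc i)) j = M≈N (suc (suc i)) j

transfer-injective : ∀ {k n} t {M N : Matrix (suc (suc k)) n} → transfer t M ≈ₘ transfer t N → M ≈ₘ N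
transfer-injective t {M} {N} tM≈tN i j =
  trans (sym (transfer-inverse t M i j)) (trans (transfer-cong (- t) tM≈tN i j) (transfer-inverse t N i j))

-- Keeping or swapping the two entries does not change a column sum.
transfer-colSums : ∀ {k n} t (M : Matrix (suc (suc k)) n) j → colSums (transfer t M) j ≡ colSums M j
transfer-colSums t M j = column-total (exchange-kept-or-swapped t (topRows M) j) _
  where
    column-total : ∀ {p q} → q ≡ p ⊎ q ≡ swap p → ∀ R →
      val (proj₁ q) + (val (proj₂ q) + R) ≡ val (proj₁ p) + (val (proj₂ p) + R)
    column-total (inj₁ refl) R = refl
    column-total {p} (inj₂ refl) R = interchange (val (proj₂ p)) (val (proj₁ p)) R
      where
        interchange : ∀ a b R → a + (b + R) ≡ b + (a + R)
        interchange = solve-∀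

HasMargins : ∀ {m n} → (Fin m → ℤ) → (Fin n → ℤ) → Matrix m n → Set
HasMargins r c M = rowSums M ≐ r × colSums M ≐ c

hasMargins? : ∀ {m n} (r : Fin m → ℤ) (c : Fin n → ℤ) → Decidable (HasMargins r c)
hasMargins? {m} {n} r c M = ≐? m (rowSums M) r ×-dec ≐? n (colSums M) c

∑-cong : ∀ n {f g : Fin n → ℤ} → (∀ i → f i ≡ g i) → ∑ n f ≡ ∑ n g
∑-cong zero    f≗g = refl
∑-cong (suc n) f≗g = cong₂ _+_ (f≗g zero) (∑-cong n (λ i → f≗g (suc i)))

hasMargins-resp : ∀ {m n} (r : Fin m → ℤ) (c : Fin n → ℤ) → HasMargins r c Respects _≈ₘ_
hasMargins-resp {m} {n} r c M≈N (rows , cols) =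
  (λ i → trans (∑-cong n (λ j → cong val (sym (M≈N i j)))) (rows i)) ,
  (λ j → trans (∑-cong m (λ i → cong val (sym (M≈N i j)))) (cols j))

-- When r₂ ≤ r₁, transfer with target 1 turns a matrix with row sums
-- r′ = (r₁ + 2, r₂ - 2, r₃, …) into one with row sums r, keeping column sums:
-- the first row exceeds the second by r₁ - r₂ + 4 ≥ 2, so exactly 2 is moved back.
transfer-restores : ∀ {k n} (r : Fin (suc (suc k)) → ℤ) (c : Fin n → ℤ) → r (suc zero) ≤ r zero →
  ∀ {M} → HasMargins (shift r) c M → HasMargins r c (transfer (+ 1) M)
transfer-restores {n = n} r c r₂≤r₁ {M} (rows , cols) = rows′ , λ j → trans (transfer-colSums (+ 1) M j) (cols j)
  where
    w : Fin n → Column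
    w = topRows M
    r₁ r₂ : ℤ
    r₁ = r zero
    r₂ = r (suc zero)

    sub-add : ∀ a → (a - + 2) + + 2 ≡ a
    sub-add = solve-∀
    add-sub : ∀ a → (a + + 2) - + 2 ≡ a
    add-sub = solve-∀

    gap : lower w + + 2 ≤ upper w
    gap = begin
      lower w + + 2          ≡⟨ cong (_+ + 2) (rows (suc zero)) ⟩
      (r₂ - + 2) + + 2       ≡⟨ sub-add r₂ ⟩
      r₂                     ≤⟨ r₂≤r₁ ⟩
      r₁                     ≤⟨ ℤ.i≤i+j r₁ (+ 2) ⟩
      r₁ + + 2               ≡⟨ sym (rows zero) ⟩
      upper w                ∎
      where open ℤ.≤-Reasoning

    moved : upper (exchange (+ 1) w) ≡ upper w - + 2 × lower (exchange (+ 1) w) ≡ lower w + + 2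
    moved = exchange-moves (+ 1) w (+≤+ z≤n) gap

    rows′ : rowSums (transfer (+ 1) M) ≐ r
    rows′ zero          = trans (proj₁ moved) (trans (cong (_- + 2) (rows zero)) (add-sub r₁))
    rows′ (suc zero)    = trans (proj₂ moved) (trans (cong (_+ + 2) (rows (suc zero))) (sub-add r₂))
    rows′ (suc (suc i)) = rows (suc (suc i))

-- The transfer injects A_{r′,c} into A_{r,c}; counting over the complete,
-- repetition-free listing allMatrices gives the inequality.
lemma3 : (k n : ℕ) → n ≥ 1 → (r : Fin (suc (suc k)) → ℤ) → (c : Fin n → ℤ) →
    r (suc zero) ≤ r zero →
    countA (suc (suc k)) n (shift r) c Data.Nat.≤ countA (suc (suc k)) n r c
lemma3 k n _ r c r₂≤r₁ =
  Counting.count-mono (Matrices m n) (hasMargins? r c) (hasMargins? (shift r) c) (hasMargins-resp r c)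
    (transfer (+ 1)) (transfer-restores r c r₂≤r₁) (transfer-injective (+ 1))
    (allMatrices m n) (allMatrices-complete m n) (allMatrices-unique m n)
  where
    m : ℕ
    m = suc (suc k)
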